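{- Let $R$ be a commutative ring and $M_n(R)$ the ring of $n\times n$ matrices over $R$. Let $a\in R$ be a nilpotent element of nilpotency index $k$, and let $s$ be the characteristic of the quotient ring $R/\langle a\rangle$. Then: (1) If $w$ is a natural number with $\bar x^{\,w}=\bar 1$ for all $\bar x\in (M_n(R/\langle a\rangle))^*$, then $x^{w s^{k-1}}=1$ for all $x\in (M_n(R))^*$. (2) If $(M_n(R/\langle a\rangle))^*$ is finite, then $x^{|(M_n(R/\langle a\rangle))^*|\, s^{k-1}}=1$ for all $x\in (M_n(R))^*$. (3) If $(M_n(R))^*$ is finite, then $x^{|(M_n(R/\langle a\rangle))^*|\,|\langle a\rangle|^{n^2}}=1$ for all $x\in (M_n(R))^*$.
   Context: Rings have identity; $S^*$ denotes the group of units of a ring $S$; $\langle a\rangle$ is the ideal generated by $a$. The characteristic of a ring $S$ is the least positive integer $s$ with $s\cdot 1_S=0$. The nilpotency index of $a$ is the least $k$ with $a^k=0$. -}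

module Defs where

open import Level using (Level; _⊔_)
open import Data.Nat using (ℕ; zero; suc; _<_)
open import Data.Fin using (Fin; zero; suc)
open import Data.Product using (Σ; ∃; _×_; _,_)
open import Relation.Nullary using (¬_)
open import Relation.Binary.PropositionalEquality using (_≡_)
open import Relation.Binary.Core using (Rel)
open import Algebra.Bundles using (RawSemiring; CommutativeRing)

module _ {c ℓ : Level} (S : RawSemiring c ℓ) where
  open RawSemiring S

  pow : Carrier → ℕ → Carrier
  pow x zero    = 1#
  pow x (suc m) = x * pow x m

  natMul : ℕ → Carrier
  natMul zero    = 0#
  natMul (suc m) = 1# + natMul m

  Mat : ℕ → Set c
  Mat n = Fin n → Fin n → Carrier

  sumF : ∀ {n} → (Fin n → Carrier) → Carrier
  sumF {zero}  f = 0#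
  sumF {suc n} f = f zero + sumF (λ i → f (suc i))

  _≈M_ : ∀ {n} → Rel (Mat n) ℓ
  A ≈M B = ∀ i j → A i j ≈ B i j

  _*M_ : ∀ {n} → Mat n → Mat n → Mat n
  (A *M B) i j = sumF (λ k → A i k * B k j)

  idM : ∀ {n} → Mat n
  idM zero    zero    = 1#
  idM zero    (suc j) = 0#
  idM (suc i) zero    = 0#
  idM (suc i) (suc j) = idM i j

  powM : ∀ {n} → Mat n → ℕ → Mat n
  powM X zero    = idM
  powM X (suc m) = X *M powM X m

  IsUnitM : ∀ {n} → Mat n → Set (c ⊔ ℓ)
  IsUnitM {n} X = Σ (Mat n) λ Y → ((X *M Y) ≈M idM) × ((Y *M X) ≈M idM)

  IsCharacteristic : ℕ → Set ℓ
  IsCharacteristic s =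
    (0 < s) × (natMul s ≈ 0#) × (∀ t → 0 < t → t < s → ¬ (natMul t ≈ 0#))

  IsNilpotencyIndex : Carrier → ℕ → Set ℓ
  IsNilpotencyIndex a k =
    (pow a k ≈ 0#) × (∀ j → j < k → ¬ (pow a j ≈ 0#))

-- A subset P of a type A, taken up to an equality _~_, is finite with
-- exactly m elements: there is an enumeration Fin m → A of elements of P
-- that is injective up to _~_ and hits every element of P up to _~_.

HasCard : ∀ {a p r} {A : Set a} → Rel A r → (A → Set p) → ℕ → Set (a ⊔ p ⊔ r)
HasCard {A = A} _~_ P m =
  Σ (Fin m → A) λ f →
    (∀ i → P (f i)) ×
    (∀ i j → f i ~ f j → i ≡ j) ×
    (∀ x → P x → ∃ λ i → x ~ f i)

module _ {c ℓ : Level} (R : CommutativeRing c ℓ) where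
  open CommutativeRing R

  InIdeal : Carrier → Carrier → Set (c ⊔ ℓ)
  InIdeal a x = ∃ λ r → x ≈ r * a

  -- R/⟨a⟩ : same carrier and operations, equality x ≡ y mod ⟨a⟩
  quotientRaw : Carrier → RawSemiring c (c ⊔ ℓ)
  quotientRaw a = record
    { Carrier = Carrier
    ; _≈_     = λ x y → InIdeal a (x - y)
    ; _+_     = _+_
    ; _*_     = _*_
    ; 0#      = 0#
    ; 1#      = 1#
    }

  baseRaw : RawSemiring c ℓ
  baseRaw = record
    { Carrier = Carrier
    ; _≈_     = _≈_
    ; _+_     = _+_
    ; _*_     = _*_
    ; 0#      = 0#
    ; 1#      = 1#
    }

-- If w kills the units of Mₙ(R/⟨a⟩), then Y = Xʷ ≡ 1 mod a for every unit X of Mₙ(R).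
-- Whenever Y ≡ 1 mod b with b ∈ ⟨a⟩, the matrix B = Y − 1 squares to 0 modulo ab, so
-- Yˢ ≡ 1 + sB ≡ 1 mod ab because s·1 ∈ ⟨a⟩.  Iterating from b = a gives Y^(s^(k−1)) ≡ 1
-- mod aᵏ = 0, which is (1); (2) is (1) with w = |Mₙ(R/⟨a⟩)*| by Lagrange's theorem.
-- For (3), Y lies in the congruence subgroup Γ = {Z : Z ≡ 1 mod a}, a group because 1 − Z
-- is nilpotent, and Z ↦ Z − 1 maps Γ bijectively onto Mₙ(⟨a⟩), which has |⟨a⟩|^(n²)
-- elements; so Lagrange's theorem applies again.
module Submission where

open import Defs
open import Level using (Level; _⊔_)
open import Data.Nat as ℕ using (ℕ; zero; suc; pred; _<_; _<?_; _∸_; NonZero; >-nonZero; >-nonZero⁻¹)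
open import Data.Nat.Properties
  using (n<1+n; m<n⇒0<n∸m; m∸n≤m; m∸n+n≡m; m+[n∸m]≡n; m<n+m; ≤-<-trans; <⇒≤; ≤-reflexive;
         suc-pred; anyUpTo?; ^-*-assoc)
import Data.Nat.Properties as ℕₚ
open import Data.Nat.Induction using (<-rec)
open import Data.Nat.Divisibility using (_∣_; divides; ∣m∣n⇒∣m+n; ∣-refl; _∣0)
open import Data.Fin using (Fin; zero; suc; toℕ; _≟_; finToFun; funToFin; combine)
open import Data.Fin.Properties using (pigeonhole; finToFun-funToFin; funToFin-finToFin)
open import Data.List using (List; []; _∷_; _++_; length; filter; applyUpTo; allFin)
open import Data.List.Properties using (length-++; length-applyUpTo; length-tabulate)
open import Data.List.Membership.Propositional using (_∈_; _∉_)
open import Data.List.Membership.Propositional.Properties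
  using (∈-applyUpTo⁺; ∈-applyUpTo⁻; ∈-filter⁺; ∈-filter⁻; ∈-++⁺ˡ; ∈-++⁺ʳ; ∈-++⁻; ∈-allFin)
open import Data.List.Membership.Propositional.Properties.WithK using (unique∧set⇒bag)
open import Data.List.Relation.Unary.Any using (here)
open import Data.List.Relation.Unary.Unique.Propositional using (Unique)
open import Data.List.Relation.Unary.Unique.Propositional.Properties using (applyUpTo⁺₁; filter⁺; ++⁺; allFin⁺)
open import Data.List.Relation.Binary.BagAndSetEquality using (_∼[_]_; set; ∼bag⇒↭)
open import Data.List.Relation.Binary.Permutation.Propositional.Properties using (↭-length)
open import Data.Product using (∃; _×_; _,_; proj₁; proj₂)
open import Data.Sum using (inj₁; inj₂)
open import Function.Bundles using (mk⇔)
open import Relation.Nullary using (¬_; Dec; yes; no)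
open import Relation.Nullary.Decidable using (¬?; _×-dec_; map′)
open import Relation.Unary using (Pred; Decidable)
open import Relation.Binary.Core using (Rel)
open import Relation.Binary.PropositionalEquality as ≡ using (_≡_; _≢_; _≗_)
open import Algebra.Bundles using (Monoid; Group; Semiring; Ring; CommutativeRing; RawSemiring)
import Function.Endo.Propositional

least-witness : ∀ {p} {P : Pred ℕ p} → Decidable P → ∀ {n} → P n →
                ∃ λ m → P m × (∀ {j} → j < m → ¬ P j)
least-witness {P = P} P? {n} = <-rec Least step n
  where
  Least : ℕ → Set _
  Least n = P n → ∃ λ m → P m × (∀ {j} → j < m → ¬ P j)
  step : ∀ n → (∀ {m} → m < n → Least m) → Least n
  step n rec Pn with anyUpTo? P? n
  ... | yes (m , m<n , Pm) = rec m<n Pm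
  ... | no ¬Pm<n           = n , Pn , λ j<n Pj → ¬Pm<n (_ , j<n , Pj)

length-unique-set : ∀ {a} {A : Set a} {xs ys : List A} →
                    Unique xs → Unique ys → xs ∼[ set ] ys → length xs ≡ length ys
length-unique-set xs! ys! xs∼ys = ↭-length (∼bag⇒↭ (unique∧set⇒bag xs! ys! xs∼ys))

module FreeAction {N : ℕ} (σ : Fin N → Fin N) (d : ℕ) .{{_ : NonZero d}} where
  open import Data.Nat using (_+_)
  open Function.Endo.Propositional (Fin N) using (_^_; ^-homo)
  open import Data.List.Membership.DecPropositional (_≟_ {N}) using (_∈?_)

  ^-suc-inner : ∀ m i → (σ ^ m) (σ i) ≡ (σ ^ suc m) i
  ^-suc-inner m i = ≡.trans (≡.sym (≡.cong-app (^-homo σ m 1) i)) (≡.cong (λ k → (σ ^ k) i) (ℕₚ.+-comm m 1))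

  orbit : Fin N → List (Fin N)
  orbit i = applyUpTo (λ j → (σ ^ j) i) d

  ∉orbit? : ∀ h → Decidable (_∉ orbit h)
  ∉orbit? h x = ¬? (x ∈? orbit h)

  orbit-removed : Fin N → List (Fin N) → List (Fin N)
  orbit-removed h = filter (∉orbit? h)

  Closed : List (Fin N) → Set
  Closed L = ∀ {x} → x ∈ L → σ x ∈ L

  ^-closed : ∀ {L} → Closed L → ∀ {h} → h ∈ L → ∀ j → (σ ^ j) h ∈ L
  ^-closed L-closed h∈L zero    = h∈L
  ^-closed L-closed h∈L (suc j) = L-closed (^-closed L-closed h∈L j)

  module _ (σ^d≗id : ∀ i → (σ ^ d) i ≡ i) (free : ∀ i {j} → 0 < j → j < d → (σ ^ j) i ≢ i) where
    open ≡.≡-Reasoning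

    σ^[d-1]∘σ≗id : ∀ i → (σ ^ pred d) (σ i) ≡ i
    σ^[d-1]∘σ≗id i = begin
      (σ ^ pred d) (σ i)    ≡⟨ ^-suc-inner (pred d) i ⟩
      (σ ^ suc (pred d)) i  ≡⟨ ≡.cong (λ k → (σ ^ k) i) (suc-pred d) ⟩
      (σ ^ d) i             ≡⟨ σ^d≗id i ⟩
      i                     ∎

    σ-injective : ∀ {i j} → σ i ≡ σ j → i ≡ j
    σ-injective {i} {j} σi≡σj = begin
      i                     ≡⟨ σ^[d-1]∘σ≗id i ⟨
      (σ ^ pred d) (σ i)    ≡⟨ ≡.cong (σ ^ pred d) σi≡σj ⟩
      (σ ^ pred d) (σ j)    ≡⟨ σ^[d-1]∘σ≗id j ⟩
      j                     ∎

    orbit-unique : ∀ i → Unique (orbit i)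
    orbit-unique i = applyUpTo⁺₁ (λ j → (σ ^ j) i) d λ {j} {k} j<k k<d σʲi≡σᵏi →
      free ((σ ^ j) i) (m<n⇒0<n∸m j<k) (≤-<-trans (m∸n≤m k j) k<d) (begin
        (σ ^ (k ∸ j)) ((σ ^ j) i)  ≡⟨ ≡.cong-app (^-homo σ (k ∸ j) j) i ⟨
        (σ ^ (k ∸ j + j)) i        ≡⟨ ≡.cong (λ m → (σ ^ m) i) (m∸n+n≡m (<⇒≤ j<k)) ⟩
        (σ ^ k) i                  ≡⟨ σʲi≡σᵏi ⟨
        (σ ^ j) i                  ∎)

    orbit-closed⁻ : ∀ {h x} → σ x ∈ orbit h → x ∈ orbit h
    orbit-closed⁻ {h} {x} σx∈ with ∈-applyUpTo⁻ (λ j → (σ ^ j) h) σx∈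
    ... | zero , _ , σx≡h = ≡.subst (_∈ orbit h) (≡.sym (σ-injective σx≡σ[σᵈ⁻¹h]))
                              (∈-applyUpTo⁺ (λ j → (σ ^ j) h) (≤-reflexive (suc-pred d)))
      where
      σx≡σ[σᵈ⁻¹h] : σ x ≡ σ ((σ ^ pred d) h)
      σx≡σ[σᵈ⁻¹h] = ≡.trans σx≡h (≡.trans (≡.sym (σ^d≗id h))
                                           (≡.cong (λ k → (σ ^ k) h) (≡.sym (suc-pred d))))
    ... | suc j , j<d , σx≡σʲ⁺¹h = ≡.subst (_∈ orbit h) (≡.sym (σ-injective σx≡σʲ⁺¹h))
                                    (∈-applyUpTo⁺ (λ j → (σ ^ j) h) (<⇒≤ j<d))

    length-orbit-removed : ∀ {L h} → Unique L → Closed L → h ∈ L →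
                           length L ≡ d + length (orbit-removed h L)
    length-orbit-removed {L} {h} L! L-closed h∈L = begin
      length L                        ≡⟨ length-unique-set L! O++rest! L∼O++rest ⟩
      length (orbit h ++ rest)        ≡⟨ length-++ (orbit h) ⟩
      length (orbit h) + length rest  ≡⟨ ≡.cong (_+ length rest) (length-applyUpTo (λ j → (σ ^ j) h) d) ⟩
      d + length rest                 ∎
      where
      rest : List (Fin N)
      rest = orbit-removed h L
      O++rest! : Unique (orbit h ++ rest)
      O++rest! = ++⁺ (orbit-unique h) (filter⁺ (∉orbit? h) L!)
                   λ (x∈O , x∈rest) → proj₂ (∈-filter⁻ (∉orbit? h) {xs = L} x∈rest) x∈O
      to : ∀ {x} → x ∈ L → x ∈ orbit h ++ rest
      to {x} x∈L with x ∈? orbit h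
      ... | yes x∈O = ∈-++⁺ˡ x∈O
      ... | no  x∉O = ∈-++⁺ʳ (orbit h) (∈-filter⁺ (∉orbit? h) x∈L x∉O)
      from : ∀ {x} → x ∈ orbit h ++ rest → x ∈ L
      from x∈ with ∈-++⁻ (orbit h) x∈
      ... | inj₁ x∈O with j , _ , ≡.refl ← ∈-applyUpTo⁻ (λ j → (σ ^ j) h) x∈O = ^-closed L-closed h∈L j
      ... | inj₂ x∈rest = proj₁ (∈-filter⁻ (∉orbit? h) {xs = L} x∈rest)
      L∼O++rest : L ∼[ set ] (orbit h ++ rest)
      L∼O++rest = mk⇔ to from

    orbit-removed-closed : ∀ {L} → Closed L → ∀ h → Closed (orbit-removed h L)
    orbit-removed-closed {L} L-closed h x∈rest with x∈L , x∉O ← ∈-filter⁻ (∉orbit? h) {xs = L} x∈rest =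
      ∈-filter⁺ (∉orbit? h) (L-closed x∈L) (λ σx∈O → x∉O (orbit-closed⁻ σx∈O))

    d∣length : ∀ L → Unique L → Closed L → d ∣ length L
    d∣length L = <-rec Divides step (length L) L ≡.refl
      where
      Divides : ℕ → Set
      Divides n = ∀ L → length L ≡ n → Unique L → Closed L → d ∣ n
      step : ∀ n → (∀ {m} → m < n → Divides m) → Divides n
      step _ rec []      ≡.refl _  _        = d ∣0
      step _ rec (h ∷ t) ≡.refl L! L-closed =
        ≡.subst (d ∣_) (≡.sym |L|≡d+|rest|) (∣m∣n⇒∣m+n ∣-refl
          (rec |rest|<|L| rest ≡.refl (filter⁺ (∉orbit? h) L!) (orbit-removed-closed L-closed h)))
        where
        rest : List (Fin N)
        rest = orbit-removed h (h ∷ t)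
        |L|≡d+|rest| : length (h ∷ t) ≡ d + length rest
        |L|≡d+|rest| = length-orbit-removed L! L-closed (here ≡.refl)
        |rest|<|L| : length rest < length (h ∷ t)
        |rest|<|L| = ≡.subst (length rest <_) (≡.sym |L|≡d+|rest|) (m<n+m (length rest) (>-nonZero⁻¹ d))

    d∣N : d ∣ N
    d∣N = ≡.subst (d ∣_) (length-tabulate (λ i → i)) (d∣length (allFin N) (allFin⁺ N) (λ _ → ∈-allFin _))

module MonoidPowers {c ℓ} (M : Monoid c ℓ) where
  open Monoid M
  open import Data.Nat using (_+_; _*_)
  open import Algebra.Properties.Monoid M using (cancelˡ; cancelᶜ)
  open import Algebra.Properties.Monoid.Mult M using (×-homo-+; ×-assocˡ; ×-congʳ) renaming (_×_ to _×ᵐ_)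
  open import Relation.Binary.Reasoning.Setoid setoid

  infixr 8 _^_
  _^_ : Carrier → ℕ → Carrier
  x ^ m = m ×ᵐ x

  ^-suc-comm : ∀ x m → x ^ suc m ≈ x ^ m ∙ x
  ^-suc-comm x m = begin
    x ^ suc m      ≡⟨ ≡.cong (x ^_) (ℕₚ.+-comm 1 m) ⟩
    x ^ (m + 1)    ≈⟨ ×-homo-+ x m 1 ⟩
    x ^ m ∙ x ^ 1  ≈⟨ ∙-congˡ (identityʳ x) ⟩
    x ^ m ∙ x      ∎

  ε^≈ε : ∀ m → ε ^ m ≈ ε
  ε^≈ε zero    = refl
  ε^≈ε (suc m) = trans (identityˡ _) (ε^≈ε m)

  record IsSubmonoid {p} (G : Pred Carrier p) : Set (c ⊔ ℓ ⊔ p) where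
    field
      resp     : ∀ {x y} → x ≈ y → G x → G y
      ε∈       : G ε
      ∙-closed : ∀ {x y} → G x → G y → G (x ∙ y)

    ^-closed : ∀ {x} → G x → ∀ m → G (x ^ m)
    ^-closed Gx zero    = ε∈
    ^-closed Gx (suc m) = ∙-closed Gx (^-closed Gx m)

  -- Right multiplication by y permutes the enumeration of G, and each of its orbits has
  -- exactly order-of-y elements.
  module Lagrange {p} {G : Pred Carrier p} (G-submonoid : IsSubmonoid G)
    (leftInverse : ∀ {x} → G x → ∃ λ x⁻¹ → x⁻¹ ∙ x ≈ ε)
    {N : ℕ} (card : HasCard _≈_ G N) {y : Carrier} (Gy : G y)
    where
    open IsSubmonoid G-submonoid
    open Function.Endo.Propositional (Fin N) using () renaming (_^_ to _^ᶠ_)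

    enum : Fin N → Carrier
    enum = proj₁ card

    enum∈G : ∀ i → G (enum i)
    enum∈G = proj₁ (proj₂ card)

    enum-injective : ∀ i j → enum i ≈ enum j → i ≡ j
    enum-injective = proj₁ (proj₂ (proj₂ card))

    enum-surjective : ∀ x → G x → ∃ λ i → x ≈ enum i
    enum-surjective = proj₂ (proj₂ (proj₂ card))

    index : ∀ {x} → G x → Fin N
    index {x} Gx = proj₁ (enum-surjective x Gx)

    ≈enum-index : ∀ {x} (Gx : G x) → x ≈ enum (index Gx)
    ≈enum-index {x} Gx = proj₂ (enum-surjective x Gx)

    index-injective : ∀ {x x′} (Gx : G x) (Gx′ : G x′) → index Gx ≡ index Gx′ → x ≈ x′
    index-injective Gx Gx′ eq = trans (≈enum-index Gx) (trans (reflexive (≡.cong enum eq)) (sym (≈enum-index Gx′)))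

    index-cong : ∀ {x x′} (Gx : G x) (Gx′ : G x′) → x ≈ x′ → index Gx ≡ index Gx′
    index-cong Gx Gx′ x≈x′ = enum-injective _ _ (trans (sym (≈enum-index Gx)) (trans x≈x′ (≈enum-index Gx′)))

    cancel : ∀ {g u} → G g → g ∙ u ≈ g → u ≈ ε
    cancel {g} {u} Gg gu≈g with g⁻¹ , g⁻¹g≈ε ← leftInverse Gg = begin
      u              ≈⟨ cancelˡ g⁻¹g≈ε u ⟨
      g⁻¹ ∙ (g ∙ u)  ≈⟨ ∙-congˡ gu≈g ⟩
      g⁻¹ ∙ g        ≈⟨ g⁻¹g≈ε ⟩
      ε              ∎

    Gy^ : ∀ m → G (y ^ m)
    Gy^ = ^-closed Gy

    IsPeriod : ℕ → Set ℓ
    IsPeriod m = 0 < m × y ^ m ≈ ε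

    isPeriod? : ∀ m → Dec (IsPeriod m)
    isPeriod? m = (0 <? m) ×-dec map′ (index-injective (Gy^ m) ε∈) (index-cong (Gy^ m) ε∈) (index (Gy^ m) ≟ index ε∈)

    period : ∃ IsPeriod
    period with i , j , i<j , yⁱ≡yʲ ← pigeonhole (n<1+n N) (λ (i : Fin (suc N)) → index (Gy^ (toℕ i))) =
      toℕ j ∸ toℕ i , m<n⇒0<n∸m i<j , cancel (Gy^ (toℕ i)) (begin
        y ^ toℕ i ∙ y ^ (toℕ j ∸ toℕ i)  ≈⟨ ×-homo-+ y (toℕ i) (toℕ j ∸ toℕ i) ⟨
        y ^ (toℕ i + (toℕ j ∸ toℕ i))    ≡⟨ ≡.cong (y ^_) (m+[n∸m]≡n (<⇒≤ i<j)) ⟩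
        y ^ toℕ j                         ≈⟨ index-injective (Gy^ (toℕ i)) (Gy^ (toℕ j)) yⁱ≡yʲ ⟨
        y ^ toℕ i                         ∎)

    order-spec : ∃ λ d → IsPeriod d × (∀ {j} → j < d → ¬ IsPeriod j)
    order-spec = least-witness isPeriod? (proj₂ period)

    order : ℕ
    order = proj₁ order-spec

    0<order : 0 < order
    0<order = proj₁ (proj₁ (proj₂ order-spec))

    yᵒʳᵈᵉʳ≈ε : y ^ order ≈ ε
    yᵒʳᵈᵉʳ≈ε = proj₂ (proj₁ (proj₂ order-spec))

    order-least : ∀ {j} → j < order → ¬ IsPeriod j
    order-least = proj₂ (proj₂ order-spec)

    σ : Fin N → Fin N
    σ i = index (∙-closed (enum∈G i) Gy)

    enum-σ^ : ∀ m i → enum ((σ ^ᶠ m) i) ≈ enum i ∙ y ^ m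
    enum-σ^ zero    i = sym (identityʳ (enum i))
    enum-σ^ (suc m) i = begin
      enum (σ ((σ ^ᶠ m) i))   ≈⟨ ≈enum-index _ ⟨
      enum ((σ ^ᶠ m) i) ∙ y   ≈⟨ ∙-congʳ (enum-σ^ m i) ⟩
      (enum i ∙ y ^ m) ∙ y    ≈⟨ assoc _ _ _ ⟩
      enum i ∙ (y ^ m ∙ y)    ≈⟨ ∙-congˡ (^-suc-comm y m) ⟨
      enum i ∙ y ^ suc m      ∎

    σ^order≗id : ∀ i → (σ ^ᶠ order) i ≡ i
    σ^order≗id i = enum-injective _ _ (begin
      enum ((σ ^ᶠ order) i)  ≈⟨ enum-σ^ order i ⟩
      enum i ∙ y ^ order     ≈⟨ ∙-congˡ yᵒʳᵈᵉʳ≈ε ⟩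
      enum i ∙ ε             ≈⟨ identityʳ (enum i) ⟩
      enum i                 ∎)

    σ^-free : ∀ i {j} → 0 < j → j < order → (σ ^ᶠ j) i ≢ i
    σ^-free i {j} 0<j j<order σʲi≡i = order-least j<order (0<j , cancel (enum∈G i) (begin
      enum i ∙ y ^ j     ≈⟨ enum-σ^ j i ⟨
      enum ((σ ^ᶠ j) i)  ≡⟨ ≡.cong enum σʲi≡i ⟩
      enum i             ∎))

    order∣N : order ∣ N
    order∣N = FreeAction.d∣N σ order {{>-nonZero 0<order}} σ^order≗id σ^-free

    lagrange : y ^ N ≈ ε
    lagrange with divides q N≡q*order ← order∣N = begin
      y ^ N            ≡⟨ ≡.cong (y ^_) N≡q*order ⟩
      y ^ (q * order)  ≈⟨ ×-assocˡ y q order ⟨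
      (y ^ order) ^ q  ≈⟨ ×-congʳ q yᵒʳᵈᵉʳ≈ε ⟩
      ε ^ q            ≈⟨ ε^≈ε q ⟩
      ε                ∎

  IsUnit : Carrier → Set (c ⊔ ℓ)
  IsUnit x = ∃ λ y → x ∙ y ≈ ε × y ∙ x ≈ ε

  units-isSubmonoid : IsSubmonoid IsUnit
  units-isSubmonoid = record
    { resp     = λ { x≈y (x⁻¹ , xx⁻¹≈ε , x⁻¹x≈ε) →
                   x⁻¹ , trans (∙-congʳ (sym x≈y)) xx⁻¹≈ε , trans (∙-congˡ (sym x≈y)) x⁻¹x≈ε }
    ; ε∈       = ε , identityˡ ε , identityˡ ε
    ; ∙-closed = λ { (x⁻¹ , xx⁻¹≈ε , x⁻¹x≈ε) (y⁻¹ , yy⁻¹≈ε , y⁻¹y≈ε) →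
                   y⁻¹ ∙ x⁻¹ , trans (cancelᶜ yy⁻¹≈ε _ x⁻¹) xx⁻¹≈ε , trans (cancelᶜ x⁻¹x≈ε y⁻¹ _) y⁻¹y≈ε }
    }

  IsExponentOfUnits : ℕ → Set (c ⊔ ℓ)
  IsExponentOfUnits w = ∀ x → IsUnit x → x ^ w ≈ ε

  card-units-isExponent : ∀ {N} → HasCard _≈_ IsUnit N → IsExponentOfUnits N
  card-units-isExponent card x = Lagrange.lagrange units-isSubmonoid (λ (x⁻¹ , _ , x⁻¹x≈ε) → x⁻¹ , x⁻¹x≈ε) card

open MonoidPowers using (IsSubmonoid; IsUnit; IsExponentOfUnits; card-units-isExponent; module Lagrange)

module _ {c ℓ} (A : Ring c ℓ) where
  open Ring A
  open import Algebra.Properties.Ring A using (x[y-z]≈xy-xz)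
  open import Algebra.Properties.Group +-group using (ε⁻¹≈ε)
  open import Algebra.Properties.Semiring.Exp semiring using (_^_)
  open import Algebra.Properties.Semiring.Mult semiring using (×-comm-*; ×-congʳ) renaming (_×_ to _·_)
  open import Relation.Binary.Reasoning.Setoid setoid

  [x-y]+[y-z]≈x-z : ∀ x y z → (x - y) + (y - z) ≈ x - z
  [x-y]+[y-z]≈x-z x y z = begin
    (x - y) + (y - z)    ≈⟨ +-assoc x (- y) (y - z) ⟩
    x + (- y + (y - z))  ≈⟨ +-congˡ (+-assoc (- y) y (- z)) ⟨
    x + ((- y + y) - z)  ≈⟨ +-congˡ (+-congʳ (-‿inverseˡ y)) ⟩
    x + (0# - z)         ≈⟨ +-congˡ (+-identityˡ (- z)) ⟩
    x - z                ∎

  ·-zeroʳ : ∀ m → m · 0# ≈ 0#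
  ·-zeroʳ zero    = refl
  ·-zeroʳ (suc m) = trans (+-identityˡ _) (·-zeroʳ m)

  [1+x]^m≈1+m·x : ∀ {x} → x * x ≈ 0# → ∀ m → (1# + x) ^ m ≈ 1# + m · x
  [1+x]^m≈1+m·x {x} x²≈0 zero    = sym (+-identityʳ 1#)
  [1+x]^m≈1+m·x {x} x²≈0 (suc m) = begin
    (1# + x) * (1# + x) ^ m                ≈⟨ *-congˡ ([1+x]^m≈1+m·x x²≈0 m) ⟩
    (1# + x) * (1# + m · x)                ≈⟨ distribʳ _ 1# x ⟩
    1# * (1# + m · x) + x * (1# + m · x)   ≈⟨ +-cong (*-identityˡ _) (distribˡ x 1# (m · x)) ⟩
    (1# + m · x) + (x * 1# + x * (m · x))  ≈⟨ +-congˡ (+-cong (*-identityʳ x) x[m·x]≈0) ⟩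
    (1# + m · x) + (x + 0#)                ≈⟨ +-congˡ (+-identityʳ x) ⟩
    (1# + m · x) + x                       ≈⟨ +-assoc 1# (m · x) x ⟩
    1# + (m · x + x)                       ≈⟨ +-congˡ (+-comm (m · x) x) ⟩
    1# + suc m · x                         ∎
    where
    x[m·x]≈0 : x * (m · x) ≈ 0#
    x[m·x]≈0 = trans (×-comm-* m x x) (trans (×-congʳ m x²≈0) (·-zeroʳ m))

  1-x∣1-x^m : ∀ x m → ∃ λ y → y * (1# - x) ≈ 1# - x ^ m
  1-x∣1-x^m x zero    = 0# , trans (zeroˡ _) (sym (-‿inverseʳ 1#))
  1-x∣1-x^m x (suc m) with y , y[1-x]≈1-xᵐ ← 1-x∣1-x^m x m = 1# + x * y , (begin
    (1# + x * y) * (1# - x)           ≈⟨ distribʳ (1# - x) 1# (x * y) ⟩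
    1# * (1# - x) + x * y * (1# - x)  ≈⟨ +-cong (*-identityˡ _) (*-assoc x y _) ⟩
    (1# - x) + x * (y * (1# - x))     ≈⟨ +-congˡ (*-congˡ y[1-x]≈1-xᵐ) ⟩
    (1# - x) + x * (1# - x ^ m)       ≈⟨ +-congˡ (x[y-z]≈xy-xz x 1# (x ^ m)) ⟩
    (1# - x) + (x * 1# - x * x ^ m)   ≈⟨ +-congˡ (+-congʳ (*-identityʳ x)) ⟩
    (1# - x) + (x - x ^ suc m)        ≈⟨ [x-y]+[y-z]≈x-z 1# x (x ^ suc m) ⟩
    1# - x ^ suc m                    ∎)

  1-x-leftInvertible : ∀ {x} m → x ^ m ≈ 0# → ∃ λ y → y * (1# - x) ≈ 1#
  1-x-leftInvertible {x} m xᵐ≈0 with y , y[1-x]≈1-xᵐ ← 1-x∣1-x^m x m = y , (begin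
    y * (1# - x)  ≈⟨ y[1-x]≈1-xᵐ ⟩
    1# - x ^ m    ≈⟨ +-congˡ (-‿cong xᵐ≈0) ⟩
    1# - 0#       ≈⟨ +-congˡ ε⁻¹≈ε ⟩
    1# + 0#       ≈⟨ +-identityʳ 1# ⟩
    1#            ∎)

module _ {a p r} {A : Set a} {_~_ : Rel A r} {P : A → Set p} {I : ℕ} where

  funToFin-cong : ∀ {m} {f g : Fin m → Fin I} → f ≗ g → funToFin f ≡ funToFin g
  funToFin-cong {zero}  f≗g = ≡.refl
  funToFin-cong {suc m} f≗g = ≡.cong₂ combine (f≗g zero) (funToFin-cong (λ i → f≗g (suc i)))

  HasCard-Π : HasCard _~_ P I → ∀ m →
              HasCard (λ f g → ∀ i → f i ~ g i) (λ f → ∀ i → P (f i)) (I ℕ.^ m)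
  HasCard-Π (enum , enum∈P , enum-injective , enum-surjective) m =
    enumΠ , (λ k i → enum∈P (finToFun k i)) , enumΠ-injective , enumΠ-surjective
    where
    enumΠ : Fin (I ℕ.^ m) → Fin m → A
    enumΠ k i = enum (finToFun k i)
    enumΠ-injective : ∀ k k′ → (∀ i → enumΠ k i ~ enumΠ k′ i) → k ≡ k′
    enumΠ-injective k k′ k~k′ = begin
      k                               ≡⟨ funToFin-finToFin {m} {I} k ⟨
      funToFin (finToFun {I} {m} k)   ≡⟨ funToFin-cong (λ i → enum-injective _ _ (k~k′ i)) ⟩
      funToFin (finToFun {I} {m} k′)  ≡⟨ funToFin-finToFin {m} {I} k′ ⟩
      k′                              ∎
      where open ≡.≡-Reasoning
    enumΠ-surjective : ∀ f → (∀ i → P (f i)) → ∃ λ k → ∀ i → f i ~ enumΠ k i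
    enumΠ-surjective f f∈P = funToFin index , λ i →
      ≡.subst (λ j → f i ~ enum j) (≡.sym (finToFun-funToFin index i)) (proj₂ (enum-surjective (f i) (f∈P i)))
      where
      index : Fin m → Fin I
      index i = proj₁ (enum-surjective (f i) (f∈P i))

module _ {c ℓ} (G : Group c ℓ) where
  open Group G
  open import Algebra.Properties.Group G using (//-rightDividesˡ; //-rightDividesʳ; ∙-cancelʳ)

  HasCard-translate : ∀ {p} {P : Carrier → Set p} {m} → (∀ {x y} → x ≈ y → P x → P y) →
                      HasCard _≈_ P m → ∀ c → HasCard _≈_ (λ z → P (z // c)) m
  HasCard-translate P-resp (enum , enum∈P , enum-injective , enum-surjective) c =
    (λ k → enum k ∙ c) ,
    (λ k → P-resp (sym (//-rightDividesʳ c (enum k))) (enum∈P k)) ,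
    (λ k k′ e → enum-injective k k′ (∙-cancelʳ c (enum k) (enum k′) e)) ,
    λ z P[z//c] → let k , z//c≈enum = enum-surjective (z // c) P[z//c] in
      k , trans (sym (//-rightDividesˡ c z)) (∙-congʳ z//c≈enum)

module MatrixRing {c ℓ} (A : Ring c ℓ) (n : ℕ) where
  open Ring A hiding (zero)
  open import Algebra.Properties.Semiring.Sum semiring
    using (sum; ∑-comm; ∑-distrib-+; *-distribˡ-sum; *-distribʳ-sum; sum-cong-≋; sum-replicate-zero)
  open import Relation.Binary.Reasoning.Setoid setoid

  raw : RawSemiring c ℓ
  raw = Semiring.rawSemiring semiring

  sumF≡sum : ∀ {m} (f : Fin m → Carrier) → sumF raw f ≡ sum f
  sumF≡sum {zero}  f = ≡.refl
  sumF≡sum {suc m} f = ≡.cong (f zero +_) (sumF≡sum (λ i → f (suc i)))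

  sum-δˡ : ∀ {m} (i : Fin m) (g : Fin m → Carrier) → sum (λ k → idM raw i k * g k) ≈ g i
  sum-δˡ {suc m} zero g = begin
    1# * g zero + sum (λ k → 0# * g (suc k))  ≈⟨ +-cong (*-identityˡ _) (sum-cong-≋ (λ k → zeroˡ (g (suc k)))) ⟩
    g zero + sum {m} (λ _ → 0#)              ≈⟨ +-congˡ (sum-replicate-zero m) ⟩
    g zero + 0#                              ≈⟨ +-identityʳ _ ⟩
    g zero                                   ∎
  sum-δˡ {suc m} (suc i) g = begin
    0# * g zero + sum (λ k → idM raw i k * g (suc k))  ≈⟨ +-cong (zeroˡ _) (sum-δˡ i (λ k → g (suc k))) ⟩
    0# + g (suc i)                                     ≈⟨ +-identityˡ _ ⟩
    g (suc i)                                          ∎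

  sum-δʳ : ∀ {m} (j : Fin m) (g : Fin m → Carrier) → sum (λ k → g k * idM raw k j) ≈ g j
  sum-δʳ {suc m} zero g = begin
    g zero * 1# + sum (λ k → g (suc k) * 0#)  ≈⟨ +-cong (*-identityʳ _) (sum-cong-≋ (λ k → zeroʳ (g (suc k)))) ⟩
    g zero + sum {m} (λ _ → 0#)              ≈⟨ +-congˡ (sum-replicate-zero m) ⟩
    g zero + 0#                              ≈⟨ +-identityʳ _ ⟩
    g zero                                   ∎
  sum-δʳ {suc m} (suc j) g = begin
    g zero * 0# + sum (λ k → g (suc k) * idM raw k j)  ≈⟨ +-cong (zeroʳ _) (sum-δʳ j (λ k → g (suc k))) ⟩
    0# + g (suc j)                                     ≈⟨ +-identityˡ _ ⟩
    g (suc j)                                          ∎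

  Matrix : Set c
  Matrix = Mat raw n

  _≈ₘ_ : Matrix → Matrix → Set ℓ
  _≈ₘ_ = _≈M_ raw

  _*ₘ_ : Matrix → Matrix → Matrix
  _*ₘ_ = _*M_ raw

  _+ₘ_ : Matrix → Matrix → Matrix
  (X +ₘ Y) i j = X i j + Y i j

  *ₘ≈∑ : ∀ (X Y : Matrix) i j → (X *ₘ Y) i j ≈ sum (λ k → X i k * Y k j)
  *ₘ≈∑ X Y i j = reflexive (sumF≡sum (λ k → X i k * Y k j))

  *ₘ-cong : ∀ {X X′ Y Y′} → X ≈ₘ X′ → Y ≈ₘ Y′ → (X *ₘ Y) ≈ₘ (X′ *ₘ Y′)
  *ₘ-cong {X} {X′} {Y} {Y′} X≈X′ Y≈Y′ i j = begin
    (X *ₘ Y) i j                    ≈⟨ *ₘ≈∑ X Y i j ⟩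
    sum (λ k → X i k * Y k j)       ≈⟨ sum-cong-≋ (λ k → *-cong (X≈X′ i k) (Y≈Y′ k j)) ⟩
    sum (λ k → X′ i k * Y′ k j)     ≈⟨ *ₘ≈∑ X′ Y′ i j ⟨
    (X′ *ₘ Y′) i j                  ∎

  *ₘ-assoc : ∀ X Y Z → ((X *ₘ Y) *ₘ Z) ≈ₘ (X *ₘ (Y *ₘ Z))
  *ₘ-assoc X Y Z i j = begin
    ((X *ₘ Y) *ₘ Z) i j                                    ≈⟨ *ₘ≈∑ (X *ₘ Y) Z i j ⟩
    sum (λ k → (X *ₘ Y) i k * Z k j)                       ≈⟨ sum-cong-≋ (λ k → *-congʳ (*ₘ≈∑ X Y i k)) ⟩
    sum (λ k → sum (λ l → X i l * Y l k) * Z k j)          ≈⟨ sum-cong-≋ (λ k → *-distribʳ-sum (Z k j) (λ l → X i l * Y l k)) ⟩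
    sum (λ k → sum (λ l → (X i l * Y l k) * Z k j))        ≈⟨ ∑-comm (λ k l → (X i l * Y l k) * Z k j) ⟩
    sum (λ l → sum (λ k → (X i l * Y l k) * Z k j))        ≈⟨ sum-cong-≋ (λ l → sum-cong-≋ (λ k → *-assoc (X i l) (Y l k) (Z k j))) ⟩
    sum (λ l → sum (λ k → X i l * (Y l k * Z k j)))        ≈⟨ sum-cong-≋ (λ l → *-distribˡ-sum (X i l) (λ k → Y l k * Z k j)) ⟨
    sum (λ l → X i l * sum (λ k → Y l k * Z k j))          ≈⟨ sum-cong-≋ (λ l → *-congˡ (*ₘ≈∑ Y Z l j)) ⟨
    sum (λ l → X i l * (Y *ₘ Z) l j)                       ≈⟨ *ₘ≈∑ X (Y *ₘ Z) i j ⟨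
    (X *ₘ (Y *ₘ Z)) i j                                    ∎

  *ₘ-identityˡ : ∀ X → (idM raw *ₘ X) ≈ₘ X
  *ₘ-identityˡ X i j = trans (*ₘ≈∑ (idM raw) X i j) (sum-δˡ i (λ k → X k j))

  *ₘ-identityʳ : ∀ X → (X *ₘ idM raw) ≈ₘ X
  *ₘ-identityʳ X i j = trans (*ₘ≈∑ X (idM raw) i j) (sum-δʳ j (λ k → X i k))

  *ₘ-distribˡ : ∀ X Y Z → (X *ₘ (Y +ₘ Z)) ≈ₘ ((X *ₘ Y) +ₘ (X *ₘ Z))
  *ₘ-distribˡ X Y Z i j = begin
    (X *ₘ (Y +ₘ Z)) i j                                    ≈⟨ *ₘ≈∑ X (Y +ₘ Z) i j ⟩
    sum (λ k → X i k * (Y k j + Z k j))                    ≈⟨ sum-cong-≋ (λ k → distribˡ (X i k) _ _) ⟩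
    sum (λ k → X i k * Y k j + X i k * Z k j)              ≈⟨ ∑-distrib-+ (λ k → X i k * Y k j) (λ k → X i k * Z k j) ⟩
    sum (λ k → X i k * Y k j) + sum (λ k → X i k * Z k j)  ≈⟨ +-cong (*ₘ≈∑ X Y i j) (*ₘ≈∑ X Z i j) ⟨
    (X *ₘ Y) i j + (X *ₘ Z) i j                            ∎

  *ₘ-distribʳ : ∀ X Y Z → ((Y +ₘ Z) *ₘ X) ≈ₘ ((Y *ₘ X) +ₘ (Z *ₘ X))
  *ₘ-distribʳ X Y Z i j = begin
    ((Y +ₘ Z) *ₘ X) i j                                    ≈⟨ *ₘ≈∑ (Y +ₘ Z) X i j ⟩
    sum (λ k → (Y i k + Z i k) * X k j)                    ≈⟨ sum-cong-≋ (λ k → distribʳ (X k j) _ _) ⟩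
    sum (λ k → Y i k * X k j + Z i k * X k j)              ≈⟨ ∑-distrib-+ (λ k → Y i k * X k j) (λ k → Z i k * X k j) ⟩
    sum (λ k → Y i k * X k j) + sum (λ k → Z i k * X k j)  ≈⟨ +-cong (*ₘ≈∑ Y X i j) (*ₘ≈∑ Z X i j) ⟨
    (Y *ₘ X) i j + (Z *ₘ X) i j                            ∎

  matrixRing : Ring c ℓ
  matrixRing = record
    { Carrier = Matrix
    ; _≈_ = _≈ₘ_
    ; _+_ = _+ₘ_
    ; _*_ = _*ₘ_
    ; -_ = λ X i j → - X i j
    ; 0# = λ i j → 0#
    ; 1# = idM raw
    ; isRing = record
      { +-isAbelianGroup = record
        { isGroup = record
          { isMonoid = record
            { isSemigroup = record
              { isMagma = record
                { isEquivalence = record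
                  { refl = λ i j → refl
                  ; sym = λ X≈Y i j → sym (X≈Y i j)
                  ; trans = λ X≈Y Y≈Z i j → trans (X≈Y i j) (Y≈Z i j)
                  }
                ; ∙-cong = λ X≈X′ Y≈Y′ i j → +-cong (X≈X′ i j) (Y≈Y′ i j)
                }
              ; assoc = λ X Y Z i j → +-assoc _ _ _
              }
            ; identity = (λ X i j → +-identityˡ _) , (λ X i j → +-identityʳ _)
            }
          ; inverse = (λ X i j → -‿inverseˡ _) , (λ X i j → -‿inverseʳ _)
          ; ⁻¹-cong = λ X≈Y i j → -‿cong (X≈Y i j)
          }
        ; comm = λ X Y i j → +-comm _ _
        }
      ; *-cong = *ₘ-cong
      ; *-assoc = *ₘ-assoc
      ; *-identity = *ₘ-identityˡ , *ₘ-identityʳ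
      ; distrib = *ₘ-distribˡ , *ₘ-distribʳ
      }
    }

  private module Mₙ = Ring matrixRing
  open import Algebra.Properties.Semiring.Exp Mₙ.semiring using (_^_)

  powM≡^ : ∀ X m → powM raw X m ≡ X ^ m
  powM≡^ X zero    = ≡.refl
  powM≡^ X (suc m) = ≡.cong (X *ₘ_) (powM≡^ X m)

  powM≈1⇒isExponentOfUnits : ∀ w → (∀ X → IsUnitM raw X → powM raw X w ≈ₘ idM raw) →
                             IsExponentOfUnits Mₙ.*-monoid w
  powM≈1⇒isExponentOfUnits w powM≈1 X X-unit = Mₙ.trans (Mₙ.reflexive (≡.sym (powM≡^ X w))) (powM≈1 X X-unit)

  isExponentOfUnits⇒powM≈1 : ∀ w → IsExponentOfUnits Mₙ.*-monoid w →
                             ∀ X → IsUnitM raw X → powM raw X w ≈ₘ idM raw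
  isExponentOfUnits⇒powM≈1 w w-exponent X X-unit = Mₙ.trans (Mₙ.reflexive (powM≡^ X w)) (w-exponent X X-unit)

module PrincipalIdeal {c ℓ} (R : CommutativeRing c ℓ) where
  open CommutativeRing R hiding (zero)
  open import Algebra.Properties.CommutativeSemigroup *-commutativeSemigroup using (interchange)
  open import Algebra.Properties.Ring ring using (-‿distribˡ-*; x[y-z]≈xy-xz; [y-z]x≈yx-zx)
  open import Algebra.Properties.AbelianGroup +-abelianGroup using (⁻¹-anti-homo‿-; ⁻¹-∙-comm; ε⁻¹≈ε)
  open import Algebra.Properties.CommutativeSemigroup +-commutativeSemigroup using () renaming (interchange to +-interchange)
  open import Algebra.Properties.Semiring.Mult semiring using (×-assoc-*; ×-congʳ) renaming (_×_ to _·_)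
  open import Relation.Binary.Reasoning.Setoid setoid

  infix 4 _∈⟨_⟩
  _∈⟨_⟩ : Carrier → Carrier → Set (c ⊔ ℓ)
  x ∈⟨ b ⟩ = InIdeal R b x

  ∈⟨⟩-resp : ∀ {b x y} → x ≈ y → x ∈⟨ b ⟩ → y ∈⟨ b ⟩
  ∈⟨⟩-resp x≈y (r , x≈rb) = r , trans (sym x≈y) x≈rb

  0∈⟨⟩ : ∀ {b} → 0# ∈⟨ b ⟩
  0∈⟨⟩ {b} = 0# , sym (zeroˡ b)

  ∈⟨1⟩ : ∀ {x} → x ∈⟨ 1# ⟩
  ∈⟨1⟩ {x} = x , sym (*-identityʳ x)

  b∈⟨b⟩ : ∀ {b} → b ∈⟨ b ⟩
  b∈⟨b⟩ {b} = 1# , sym (*-identityˡ b)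

  +-∈⟨⟩ : ∀ {b x y} → x ∈⟨ b ⟩ → y ∈⟨ b ⟩ → x + y ∈⟨ b ⟩
  +-∈⟨⟩ {b} (r , x≈rb) (r′ , y≈r′b) = r + r′ , trans (+-cong x≈rb y≈r′b) (sym (distribʳ b r r′))

  -‿∈⟨⟩ : ∀ {b x} → x ∈⟨ b ⟩ → - x ∈⟨ b ⟩
  -‿∈⟨⟩ {b} (r , x≈rb) = - r , trans (-‿cong x≈rb) (-‿distribˡ-* r b)

  *-∈⟨⟩ : ∀ {b b′ x y} → x ∈⟨ b ⟩ → y ∈⟨ b′ ⟩ → x * y ∈⟨ b * b′ ⟩
  *-∈⟨⟩ {b} {b′} (r , x≈rb) (r′ , y≈r′b′) = r * r′ , trans (*-cong x≈rb y≈r′b′) (interchange r b r′ b′)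

  ∈⟨⟩-*ˡ : ∀ {b x} y → x ∈⟨ b ⟩ → y * x ∈⟨ b ⟩
  ∈⟨⟩-*ˡ {b} y (r , x≈rb) = y * r , trans (*-congˡ x≈rb) (sym (*-assoc y r b))

  ∈⟨⟩-*ʳ : ∀ {b x} y → x ∈⟨ b ⟩ → x * y ∈⟨ b ⟩
  ∈⟨⟩-*ʳ {x = x} y x∈⟨b⟩ = ∈⟨⟩-resp (*-comm y x) (∈⟨⟩-*ˡ y x∈⟨b⟩)

  ∈⟨⟩-trans : ∀ {b b′ x} → x ∈⟨ b ⟩ → b ∈⟨ b′ ⟩ → x ∈⟨ b′ ⟩
  ∈⟨⟩-trans {b} {b′} (r , x≈rb) (r′ , b≈r′b′) = r * r′ , trans x≈rb (trans (*-congˡ b≈r′b′) (sym (*-assoc r r′ b′)))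

  ∈⟨0⟩ : ∀ {b x} → b ≈ 0# → x ∈⟨ b ⟩ → x ≈ 0#
  ∈⟨0⟩ {b} {x} b≈0 (r , x≈rb) = trans x≈rb (trans (*-congˡ b≈0) (zeroʳ r))

  sumF-∈⟨⟩ : ∀ {b m} {g : Fin m → Carrier} → (∀ k → g k ∈⟨ b ⟩) → sumF (baseRaw R) g ∈⟨ b ⟩
  sumF-∈⟨⟩ {m = zero}  g∈ = 0∈⟨⟩
  sumF-∈⟨⟩ {m = suc m} g∈ = +-∈⟨⟩ (g∈ zero) (sumF-∈⟨⟩ (λ k → g∈ (suc k)))

  natMul≡·1 : ∀ s → natMul (baseRaw R) s ≡ s · 1#
  natMul≡·1 zero    = ≡.refl
  natMul≡·1 (suc s) = ≡.cong (1# +_) (natMul≡·1 s)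

  ·-∈⟨⟩ : ∀ {a b x} s → natMul (baseRaw R) s ∈⟨ a ⟩ → x ∈⟨ b ⟩ → s · x ∈⟨ a * b ⟩
  ·-∈⟨⟩ {x = x} s s∈⟨a⟩ x∈⟨b⟩ =
    ∈⟨⟩-resp (trans (×-assoc-* s 1# x) (×-congʳ s (*-identityˡ x)))
      (*-∈⟨⟩ (∈⟨⟩-resp (reflexive (natMul≡·1 s)) s∈⟨a⟩) x∈⟨b⟩)

  x-0≈x : ∀ x → x - 0# ≈ x
  x-0≈x x = trans (+-congˡ ε⁻¹≈ε) (+-identityʳ x)

  module _ (b : Carrier) where

    infix 4 _≈q_
    _≈q_ : Carrier → Carrier → Set (c ⊔ ℓ)
    x ≈q y = x - y ∈⟨ b ⟩

    ∈⟨⟩⇒≈q0 : ∀ {x} → x ∈⟨ b ⟩ → x ≈q 0#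
    ∈⟨⟩⇒≈q0 {x} = ∈⟨⟩-resp (sym (x-0≈x x))

    ≈q0⇒∈⟨⟩ : ∀ {x} → x ≈q 0# → x ∈⟨ b ⟩
    ≈q0⇒∈⟨⟩ {x} = ∈⟨⟩-resp (x-0≈x x)

    ≈⇒≈q : ∀ {x y} → x ≈ y → x ≈q y
    ≈⇒≈q {x} {y} x≈y = ∈⟨⟩-resp (trans (sym (-‿inverseʳ y)) (+-congʳ (sym x≈y))) 0∈⟨⟩

    ≈q-sym : ∀ {x y} → x ≈q y → y ≈q x
    ≈q-sym {x} {y} x≈qy = ∈⟨⟩-resp (⁻¹-anti-homo‿- x y) (-‿∈⟨⟩ x≈qy)

    ≈q-trans : ∀ {x y z} → x ≈q y → y ≈q z → x ≈q z
    ≈q-trans {x} {y} {z} x≈qy y≈qz = ∈⟨⟩-resp ([x-y]+[y-z]≈x-z ring x y z) (+-∈⟨⟩ x≈qy y≈qz)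

    +-congq : ∀ {x y u v} → x ≈q y → u ≈q v → x + u ≈q y + v
    +-congq {x} {y} {u} {v} x≈qy u≈qv = ∈⟨⟩-resp (begin
      (x - y) + (u - v)        ≈⟨ +-interchange x (- y) u (- v) ⟩
      (x + u) + (- y + - v)    ≈⟨ +-congˡ (⁻¹-∙-comm y v) ⟩
      (x + u) - (y + v)        ∎) (+-∈⟨⟩ x≈qy u≈qv)

    *-congq : ∀ {x y u v} → x ≈q y → u ≈q v → x * u ≈q y * v
    *-congq {x} {y} {u} {v} x≈qy u≈qv = ∈⟨⟩-resp (begin
      (x - y) * u + y * (u - v)          ≈⟨ +-cong ([y-z]x≈yx-zx u x y) (x[y-z]≈xy-xz y u v) ⟩
      (x * u - y * u) + (y * u - y * v)  ≈⟨ [x-y]+[y-z]≈x-z ring (x * u) (y * u) (y * v) ⟩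
      x * u - y * v                      ∎) (+-∈⟨⟩ (∈⟨⟩-*ʳ u x≈qy) (∈⟨⟩-*ˡ y u≈qv))

    -‿congq : ∀ {x y} → x ≈q y → - x ≈q - y
    -‿congq {x} {y} x≈qy = ∈⟨⟩-resp (sym (⁻¹-∙-comm x (- y))) (-‿∈⟨⟩ x≈qy)

  quotientRing : Carrier → CommutativeRing c (c ⊔ ℓ)
  quotientRing b = record
    { Carrier = Carrier
    ; _≈_ = _≈q_ b
    ; _+_ = _+_
    ; _*_ = _*_
    ; -_ = -_
    ; 0# = 0#
    ; 1# = 1#
    ; isCommutativeRing = record
      { isRing = record
        { +-isAbelianGroup = record
          { isGroup = record
            { isMonoid = record
              { isSemigroup = record
                { isMagma = record
                  { isEquivalence = record { refl = ≈⇒≈q b refl ; sym = ≈q-sym b ; trans = ≈q-trans b }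
                  ; ∙-cong = +-congq b
                  }
                ; assoc = λ x y z → ≈⇒≈q b (+-assoc x y z)
                }
              ; identity = (λ x → ≈⇒≈q b (+-identityˡ x)) , (λ x → ≈⇒≈q b (+-identityʳ x))
              }
            ; inverse = (λ x → ≈⇒≈q b (-‿inverseˡ x)) , (λ x → ≈⇒≈q b (-‿inverseʳ x))
            ; ⁻¹-cong = -‿congq b
            }
          ; comm = λ x y → ≈⇒≈q b (+-comm x y)
          }
        ; *-cong = *-congq b
        ; *-assoc = λ x y z → ≈⇒≈q b (*-assoc x y z)
        ; *-identity = (λ x → ≈⇒≈q b (*-identityˡ x)) , (λ x → ≈⇒≈q b (*-identityʳ x))
        ; distrib = (λ x y z → ≈⇒≈q b (distribˡ x y z)) , (λ x y z → ≈⇒≈q b (distribʳ x y z))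
        }
      ; *-comm = λ x y → ≈⇒≈q b (*-comm x y)
      }
    }

module Congruences {c ℓ} (R : CommutativeRing c ℓ) (n : ℕ) where
  open CommutativeRing R using (Carrier; ring; _≈_; _+_; _*_; 0#; 1#)
  open import Algebra.Properties.Semiring.Mult (CommutativeRing.semiring R) using () renaming (_×_ to _·_)
  open PrincipalIdeal R

  Matrix : Set c
  Matrix = Mat (baseRaw R) n

  Mₙ : Ring c ℓ
  Mₙ = MatrixRing.matrixRing ring n

  Mₙ/ : Carrier → Ring c (c ⊔ ℓ)
  Mₙ/ b = MatrixRing.matrixRing (CommutativeRing.ring (quotientRing b)) n

  module M where
    open Ring Mₙ public
    open import Algebra.Properties.Semiring.Exp semiring public using (_^_; ^-assocʳ)

  module M/ (b : Carrier) where
    open Ring (Mₙ/ b) public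
    open import Algebra.Properties.Semiring.Exp semiring public using (_^_; ^-congˡ)
    open import Algebra.Properties.Semiring.Mult semiring public using () renaming (_×_ to _·_)

  infix 4 _≡_mod_
  _≡_mod_ : Matrix → Matrix → Carrier → Set (c ⊔ ℓ)
  X ≡ Y mod b = _≈M_ (quotientRaw R b) X Y

  module _ {b : Carrier} where
    private module Q = M/ b

    sumF-reduce : ∀ {m} (g : Fin m → Carrier) → sumF (quotientRaw R b) g ≡ sumF (baseRaw R) g
    sumF-reduce {zero}  g = ≡.refl
    sumF-reduce {suc m} g = ≡.cong (g zero +_) (sumF-reduce (λ k → g (suc k)))

    idM-reduce : ∀ {m} (i j : Fin m) → idM (quotientRaw R b) i j ≡ idM (baseRaw R) i j
    idM-reduce zero    zero    = ≡.refl
    idM-reduce zero    (suc j) = ≡.refl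
    idM-reduce (suc i) zero    = ≡.refl
    idM-reduce (suc i) (suc j) = idM-reduce i j

    natMul-reduce : ∀ m → natMul (quotientRaw R b) m ≡ natMul (baseRaw R) m
    natMul-reduce zero    = ≡.refl
    natMul-reduce (suc m) = ≡.cong (1# +_) (natMul-reduce m)

    reduce : ∀ {X Y} → X M.≈ Y → X ≡ Y mod b
    reduce X≈Y i j = ≈⇒≈q b (X≈Y i j)

    *-reduce : ∀ X Y → X M.* Y ≡ X Q.* Y mod b
    *-reduce X Y i j = ≈⇒≈q b (CommutativeRing.reflexive R (≡.sym (sumF-reduce (λ k → X i k * Y k j))))

    1-reduce : M.1# ≡ Q.1# mod b
    1-reduce i j = ≈⇒≈q b (CommutativeRing.reflexive R (≡.sym (idM-reduce i j)))

    ^-reduce : ∀ X m → X M.^ m ≡ X Q.^ m mod b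
    ^-reduce X zero    = 1-reduce
    ^-reduce X (suc m) = Q.trans (*-reduce X (X M.^ m)) (Q.*-congˡ (^-reduce X m))

    ·-entry : ∀ s (B : Matrix) i j → (s Q.· B) i j ≡ s · B i j
    ·-entry zero    B i j = ≡.refl
    ·-entry (suc s) B i j = ≡.cong (B i j +_) (·-entry s B i j)

  mod-weaken : ∀ {b b′ X Y} → b ∈⟨ b′ ⟩ → X ≡ Y mod b → X ≡ Y mod b′
  mod-weaken b∈⟨b′⟩ X≡Y i j = ∈⟨⟩-trans (X≡Y i j) b∈⟨b′⟩

  ≡mod0⇒≈ : ∀ {b X Y} → b ≈ 0# → X ≡ Y mod b → X M.≈ Y
  ≡mod0⇒≈ b≈0 X≡Y i j = x∙y⁻¹≈ε⇒x≈y _ _ (∈⟨0⟩ b≈0 (X≡Y i j))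
    where open import Algebra.Properties.Group (CommutativeRing.+-group R) using (x∙y⁻¹≈ε⇒x≈y)

  infix 4 _∈Mₙ⟨_⟩
  _∈Mₙ⟨_⟩ : Matrix → Carrier → Set (c ⊔ ℓ)
  X ∈Mₙ⟨ b ⟩ = ∀ i j → X i j ∈⟨ b ⟩

  ∈Mₙ⟨⟩⇒≡0 : ∀ {b X} → X ∈Mₙ⟨ b ⟩ → X ≡ M.0# mod b
  ∈Mₙ⟨⟩⇒≡0 {b} X∈ i j = ∈⟨⟩⇒≈q0 b (X∈ i j)

  *-∈Mₙ⟨⟩ : ∀ {b b′ X Y} → X ∈Mₙ⟨ b ⟩ → Y ∈Mₙ⟨ b′ ⟩ → X M.* Y ∈Mₙ⟨ b * b′ ⟩
  *-∈Mₙ⟨⟩ X∈ Y∈ i j = sumF-∈⟨⟩ (λ k → *-∈⟨⟩ (X∈ i k) (Y∈ k j))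

  ^-∈Mₙ⟨⟩ : ∀ {b X} → X ∈Mₙ⟨ b ⟩ → ∀ m → X M.^ m ∈Mₙ⟨ pow (baseRaw R) b m ⟩
  ^-∈Mₙ⟨⟩ X∈ zero    i j = ∈⟨1⟩
  ^-∈Mₙ⟨⟩ X∈ (suc m) = *-∈Mₙ⟨⟩ X∈ (^-∈Mₙ⟨⟩ X∈ m)

  ·-∈Mₙ⟨⟩ : ∀ {a b b′ B} s → natMul (baseRaw R) s ∈⟨ a ⟩ → B ∈Mₙ⟨ b′ ⟩ → M/._·_ b s B ∈Mₙ⟨ a * b′ ⟩
  ·-∈Mₙ⟨⟩ {b = b} {B = B} s s∈⟨a⟩ B∈ i j =
    ∈⟨⟩-resp (CommutativeRing.reflexive R (≡.sym (·-entry {b} s B i j))) (·-∈⟨⟩ s s∈⟨a⟩ (B∈ i j))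

  congruence-step : ∀ {a b s Y} → b ∈⟨ a ⟩ → natMul (baseRaw R) s ∈⟨ a ⟩ →
                    Y ≡ M.1# mod b → Y M.^ s ≡ M.1# mod a * b
  congruence-step {a} {b} {s} {Y} b∈⟨a⟩ s∈⟨a⟩ Y≡1 = begin
    Y M.^ s                ≈⟨ ^-reduce Y s ⟩
    Y Q.^ s                ≈⟨ Q.^-congˡ s Y≈1+B ⟩
    (Q.1# Q.+ B) Q.^ s     ≈⟨ [1+x]^m≈1+m·x (Mₙ/ (a * b)) B²≈0 s ⟩
    Q.1# Q.+ s Q.· B       ≈⟨ Q.+-congˡ (∈Mₙ⟨⟩⇒≡0 (·-∈Mₙ⟨⟩ {b = a * b} s s∈⟨a⟩ Y≡1)) ⟩
    Q.1# Q.+ Q.0#          ≈⟨ Q.+-identityʳ Q.1# ⟩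
    Q.1#                   ≈⟨ 1-reduce ⟨
    M.1#                   ∎
    where
    module Q = M/ (a * b)
    open import Relation.Binary.Reasoning.Setoid Q.setoid
    open import Algebra.Properties.Group M.+-group using (//-rightDividesˡ)
    B : Matrix
    B = Y M.- M.1#
    Y≈1+B : Y Q.≈ Q.1# Q.+ B
    Y≈1+B = Q.trans (reduce (M.trans (M.sym (//-rightDividesˡ M.1# Y)) (M.+-comm B M.1#))) (Q.+-congʳ 1-reduce)
    B²≈0 : B Q.* B Q.≈ Q.0#
    B²≈0 = Q.trans (Q.sym (*-reduce B B))
             (∈Mₙ⟨⟩⇒≡0 λ i j → ∈⟨⟩-trans (*-∈Mₙ⟨⟩ Y≡1 Y≡1 i j) (*-∈⟨⟩ b∈⟨a⟩ b∈⟨b⟩))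

  congruence-lift : ∀ {a s Y} → natMul (baseRaw R) s ∈⟨ a ⟩ → Y ≡ M.1# mod a →
                    ∀ k → Y M.^ (s ℕ.^ (k ℕ.∸ 1)) ≡ M.1# mod pow (baseRaw R) a k
  congruence-lift s∈⟨a⟩ Y≡1 zero i j = ∈⟨1⟩
  congruence-lift {a} {s} {Y} s∈⟨a⟩ Y≡1 (suc zero) =
    mod-weaken (∈⟨⟩-resp (CommutativeRing.*-identityʳ R a) b∈⟨b⟩) (M/.trans a (reduce (M.*-identityʳ Y)) Y≡1)
  congruence-lift {a} {s} {Y} s∈⟨a⟩ Y≡1 (suc (suc k)) =
    M/.trans (pow (baseRaw R) a (suc (suc k))) (reduce Yˢ^ᵏ⁺¹≈[Yˢ^ᵏ]ˢ)
      (congruence-step {s = s} aᵏ⁺¹∈⟨a⟩ s∈⟨a⟩ (congruence-lift {s = s} s∈⟨a⟩ Y≡1 (suc k)))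
    where
    aᵏ⁺¹∈⟨a⟩ : pow (baseRaw R) a (suc k) ∈⟨ a ⟩
    aᵏ⁺¹∈⟨a⟩ = ∈⟨⟩-*ʳ (pow (baseRaw R) a k) b∈⟨b⟩
    Yˢ^ᵏ⁺¹≈[Yˢ^ᵏ]ˢ : Y M.^ (s ℕ.^ suc k) M.≈ (Y M.^ (s ℕ.^ k)) M.^ s
    Yˢ^ᵏ⁺¹≈[Yˢ^ᵏ]ˢ = M.trans (M.reflexive (≡.cong (Y M.^_) (ℕₚ.*-comm s (s ℕ.^ k))))
                             (M.sym (M.^-assocʳ Y (s ℕ.^ k) s))

  reduce-isUnit : ∀ {b X} → IsUnit M.*-monoid X → IsUnit (M/.*-monoid b) X
  reduce-isUnit {b} {X} (Y , XY≈1 , YX≈1) = Y , reduce-≈1 X Y XY≈1 , reduce-≈1 Y X YX≈1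
    where
    module Q = M/ b
    reduce-≈1 : ∀ U V → U M.* V M.≈ M.1# → U Q.* V Q.≈ Q.1#
    reduce-≈1 U V UV≈1 = Q.trans (Q.sym (*-reduce U V)) (Q.trans (reduce UV≈1) 1-reduce)

  Γ : Carrier → Matrix → Set (c ⊔ ℓ)
  Γ a Z = Z ≡ M.1# mod a

  Γ-isSubmonoid : ∀ {a} → IsSubmonoid M.*-monoid (Γ a)
  Γ-isSubmonoid {a} = record
    { resp     = λ Z≈W Z≡1 → Q.trans (Q.sym (reduce Z≈W)) Z≡1
    ; ε∈       = Q.refl
    ; ∙-closed = λ {Z} {W} Z≡1 W≡1 → Q.trans (*-reduce Z W) (Q.trans (Q.*-cong (≡1q Z≡1) (≡1q W≡1))
                   (Q.trans (Q.*-identityˡ Q.1#) (Q.sym 1-reduce)))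
    }
    where
    module Q = M/ a
    ≡1q : ∀ {Z} → Γ a Z → Z Q.≈ Q.1#
    ≡1q Z≡1 = Q.trans Z≡1 1-reduce

  Γ-leftInvertible : ∀ {a k} → pow (baseRaw R) a k ≈ 0# → ∀ {Z} → Γ a Z → ∃ λ W → W M.* Z M.≈ M.1#
  Γ-leftInvertible {a} {k} aᵏ≈0 {Z} Z≡1 =
    let W , W[1-C]≈1 = 1-x-leftInvertible Mₙ k Cᵏ≈0 in W , M.trans (M.*-congˡ Z≈1-C) W[1-C]≈1
    where
    open import Algebra.Properties.AbelianGroup M.+-abelianGroup using (⁻¹-anti-homo‿-)
    open import Algebra.Properties.Group M.+-group using (//-rightDividesˡ)
    C : Matrix
    C = M.1# M.- Z
    C∈Mₙ⟨a⟩ : C ∈Mₙ⟨ a ⟩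
    C∈Mₙ⟨a⟩ i j = ∈⟨⟩-resp (⁻¹-anti-homo‿- Z M.1# i j) (-‿∈⟨⟩ (Z≡1 i j))
    Cᵏ≈0 : C M.^ k M.≈ M.0#
    Cᵏ≈0 i j = ∈⟨0⟩ aᵏ≈0 (^-∈Mₙ⟨⟩ C∈Mₙ⟨a⟩ k i j)
    Z≈1-C : Z M.≈ M.1# M.- C
    Z≈1-C = M.sym (M.trans (M.+-congˡ (⁻¹-anti-homo‿- M.1# Z)) (M.trans (M.+-comm M.1# (Z M.- M.1#)) (//-rightDividesˡ M.1# Z)))

  Γ-card : ∀ {a I} → HasCard _≈_ (_∈⟨ a ⟩) I → HasCard M._≈_ (Γ a) (I ℕ.^ (n ℕ.* n))
  Γ-card {a} {I} cardI = ≡.subst (HasCard M._≈_ (Γ a)) (^-*-assoc I n n)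
    (HasCard-translate M.+-group (λ X≈Y X∈ i j → ∈⟨⟩-resp (X≈Y i j) (X∈ i j))
      (HasCard-Π {_~_ = λ u v → ∀ j → u j ≈ v j} (HasCard-Π {_~_ = _≈_} cardI n) n) M.1#)

  ≡1-mod-of-isExponent : ∀ {a} w {X} → IsExponentOfUnits (M/.*-monoid a) w →
                         IsUnit M.*-monoid X → X M.^ w ≡ M.1# mod a
  ≡1-mod-of-isExponent {a} w {X} w-exponent X-unit =
    Q.trans (^-reduce X w) (Q.trans (w-exponent X (reduce-isUnit X-unit)) (Q.sym 1-reduce))
    where module Q = M/ a

  isExponent-lifting : ∀ {a} k s w → pow (baseRaw R) a k ≈ 0# → natMul (baseRaw R) s ∈⟨ a ⟩ →
                       IsExponentOfUnits (M/.*-monoid a) w →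
                       IsExponentOfUnits M.*-monoid (w ℕ.* s ℕ.^ (k ℕ.∸ 1))
  isExponent-lifting k s w aᵏ≈0 s∈⟨a⟩ w-exponent X X-unit =
    M.trans (M.sym (M.^-assocʳ X w (s ℕ.^ (k ℕ.∸ 1))))
      (≡mod0⇒≈ aᵏ≈0 (congruence-lift {s = s} s∈⟨a⟩ (≡1-mod-of-isExponent w w-exponent X-unit) k))

  isExponent-via-Γ : ∀ {a} k I N → pow (baseRaw R) a k ≈ 0# → HasCard _≈_ (_∈⟨ a ⟩) I →
                     IsExponentOfUnits (M/.*-monoid a) N →
                     IsExponentOfUnits M.*-monoid (N ℕ.* I ℕ.^ (n ℕ.* n))
  isExponent-via-Γ k I N aᵏ≈0 cardI N-exponent X X-unit =
    M.trans (M.sym (M.^-assocʳ X N (I ℕ.^ (n ℕ.* n))))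
      (Lagrange.lagrange M.*-monoid Γ-isSubmonoid (Γ-leftInvertible {k = k} aᵏ≈0) (Γ-card cardI)
        (≡1-mod-of-isExponent N N-exponent X-unit))

  characteristic∈⟨⟩ : ∀ {a s} → IsCharacteristic (quotientRaw R a) s → natMul (baseRaw R) s ∈⟨ a ⟩
  characteristic∈⟨⟩ {a} {s} (_ , s·1≈0 , _) =
    ≈q0⇒∈⟨⟩ a (≡.subst (λ x → _≈q_ a x (CommutativeRing.0# R)) (natMul-reduce s) s·1≈0)

open import Data.Nat using (_*_; _^_)

corollary4p3 : ∀ {c ℓ : Level} (R : CommutativeRing c ℓ) (n : ℕ)
    (a : CommutativeRing.Carrier R) (k s : ℕ) →
    IsNilpotencyIndex (baseRaw R) a k →
    IsCharacteristic (quotientRaw R a) s →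
    -- (1)
    (∀ (w : ℕ) →
      (∀ (X : Mat (quotientRaw R a) n) → IsUnitM (quotientRaw R a) X →
        _≈M_ (quotientRaw R a) (powM (quotientRaw R a) X w) (idM (quotientRaw R a))) →
      ∀ (X : Mat (baseRaw R) n) → IsUnitM (baseRaw R) X →
        _≈M_ (baseRaw R)
          (powM (baseRaw R) X (w * s ^ (k ∸ 1)))
          (idM (baseRaw R)))
    ×
    -- (2)
    (∀ (N : ℕ) →
      HasCard (_≈M_ (quotientRaw R a) {n}) (IsUnitM (quotientRaw R a)) N →
      ∀ (X : Mat (baseRaw R) n) → IsUnitM (baseRaw R) X →
        _≈M_ (baseRaw R)
          (powM (baseRaw R) X (N * s ^ (k ∸ 1)))
          (idM (baseRaw R)))
    ×
    -- (3)
    (∀ (M N I : ℕ) →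
      HasCard (_≈M_ (baseRaw R) {n}) (IsUnitM (baseRaw R)) M →
      HasCard (_≈M_ (quotientRaw R a) {n}) (IsUnitM (quotientRaw R a)) N →
      HasCard (CommutativeRing._≈_ R) (InIdeal R a) I →
      ∀ (X : Mat (baseRaw R) n) → IsUnitM (baseRaw R) X →
        _≈M_ (baseRaw R)
          (powM (baseRaw R) X (N * I ^ (n * n)))
          (idM (baseRaw R)))
corollary4p3 R n a k s (aᵏ≈0 , _) s-char =
  (λ w powMʷ≈1 → isExponentOfUnits⇒powM≈1 (w * s ^ (k ∸ 1))
                   (isExponent-lifting k s w aᵏ≈0 s∈⟨a⟩ (powM≈1⇒isExponentOfUnits w powMʷ≈1))) ,
  (λ N cardN → isExponentOfUnits⇒powM≈1 (N * s ^ (k ∸ 1))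
                 (isExponent-lifting k s N aᵏ≈0 s∈⟨a⟩ (card-units-isExponent (M/.*-monoid a) cardN))) ,
  (λ _ N I _ cardN cardI → isExponentOfUnits⇒powM≈1 (N * I ^ (n * n))
                             (isExponent-via-Γ k I N aᵏ≈0 cardI (card-units-isExponent (M/.*-monoid a) cardN)))
  where
  open Congruences R n
  open MatrixRing (CommutativeRing.ring R) n using (isExponentOfUnits⇒powM≈1)
  open MatrixRing (CommutativeRing.ring (PrincipalIdeal.quotientRing R a)) n using (powM≈1⇒isExponentOfUnits)
  s∈⟨a⟩ : InIdeal R a (natMul (baseRaw R) s)
  s∈⟨a⟩ = characteristic∈⟨⟩ s-char
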